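{- Let $h(x,y)=Ax^4+Bxy^3+Cy^4\in\mathbb{F}_5[x,y]$ with $AC\neq 0$. Then for any $D,E,F\in\mathbb{F}_5$ with $F\neq 0$, either the form \[g(x,y,z):=h(x,y)+Dxz^3+Eyz^3+Fz^4\] has at least one non-singular zero over $\mathbb{F}_5$, or after a permutation of the variables $x,y,z$ one has \[g(x,y,z)=c(x^4+y^4+z^4)\quad\text{or}\quad c(2x^4+y^4+z^4)\quad\text{or}\quad c(x^4+y^4+dxz^3+3z^4)\] for certain $c,d\in\mathbb{F}_5\setminus\{0\}$.
   Context: A non-singular zero of a form over $\mathbb{F}_5$ is a non-zero vector over $\mathbb{F}_5$ at which the form vanishes but not all of its partial derivatives vanish. -}

module Defs where

open import Data.Nat as ℕ using (ℕ; zero; suc)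
open import Data.Nat.DivMod using (_mod_)
open import Data.Fin using (Fin; toℕ) renaming (zero to fzero; suc to fsuc)
open import Data.Fin.Permutation using (Permutation′; _⟨$⟩ʳ_)
open import Data.Vec using (Vec; _∷_; []; lookup; tabulate; updateAt)
open import Data.Vec.Properties using (≡-dec)
open import Data.List using (List; _∷_; []; map; foldr)
open import Data.Product using (_×_; _,_; ∃; ∃-syntax; Σ-syntax)
open import Relation.Nullary using (¬_; yes; no)
open import Relation.Binary.PropositionalEquality using (_≡_)

F5 : Set
F5 = Fin 5

fromℕ5 : ℕ → F5
fromℕ5 n = n mod 5

infixl 6 _⊕_
infixl 7 _⊗_
_⊕_ : F5 → F5 → F5
a ⊕ b = fromℕ5 (toℕ a ℕ.+ toℕ b)

_⊗_ : F5 → F5 → F5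
a ⊗ b = fromℕ5 (toℕ a ℕ.* toℕ b)

_^_ : F5 → ℕ → F5
a ^ zero = fromℕ5 1
a ^ suc n = a ⊗ (a ^ n)

𝟘 : F5
𝟘 = fromℕ5 0

-- Polynomials in three variables x₀ = x, x₁ = y, x₂ = z over F₅:
-- a finite list of terms (coefficient, exponent vector).
Term : Set
Term = F5 × Vec ℕ 3

Poly : Set
Poly = List Term

coeff : Poly → Vec ℕ 3 → F5
coeff [] e = 𝟘
coeff ((c , e′) ∷ p) e with ≡-dec ℕ._≟_ e′ e
... | yes _ = c ⊕ coeff p e
... | no _ = coeff p e

_≐_ : Poly → Poly → Set
p ≐ q = ∀ e → coeff p e ≡ coeff q e

evalTerm : (Fin 3 → F5) → Term → F5
evalTerm v (c , e) =
  c ⊗ (v fzero ^ lookup e fzero)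
    ⊗ (v (fsuc fzero) ^ lookup e (fsuc fzero))
    ⊗ (v (fsuc (fsuc fzero)) ^ lookup e (fsuc (fsuc fzero)))

eval : Poly → (Fin 3 → F5) → F5
eval p v = foldr (λ t acc → evalTerm v t ⊕ acc) 𝟘 p

∂Term : Fin 3 → Term → Term
∂Term i (c , e) = (c ⊗ fromℕ5 (lookup e i) , updateAt e i ℕ.pred)

∂ : Fin 3 → Poly → Poly
∂ i = map (∂Term i)

-- substitution x_j ↦ x_{π j}  (renaming / permutation of the variables)
renTerm : Permutation′ 3 → Term → Term
renTerm π (c , e) = (c , tabulate (λ j → lookup e (π ⟨$⟩ʳ j)))

ren : Permutation′ 3 → Poly → Poly
ren π = map (renTerm π)

NonSingularZero : Poly → (Fin 3 → F5) → Set
NonSingularZero g v =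
  (¬ (∀ i → v i ≡ 𝟘)) × (eval g v ≡ 𝟘) × (¬ (∀ i → eval (∂ i g) v ≡ 𝟘))

HasNonSingularZero : Poly → Set
HasNonSingularZero g = ∃[ v ] NonSingularZero g v

mono : ℕ → ℕ → ℕ → Vec ℕ 3
mono a b c = a ∷ b ∷ c ∷ []

gForm : (A B C D E F : F5) → Poly
gForm A B C D E F =
  (A , mono 4 0 0) ∷ (B , mono 1 3 0) ∷ (C , mono 0 4 0) ∷
  (D , mono 1 0 3) ∷ (E , mono 0 1 3) ∷ (F , mono 0 0 4) ∷ []

form₁ : F5 → Poly
form₁ c = (c , mono 4 0 0) ∷ (c , mono 0 4 0) ∷ (c , mono 0 0 4) ∷ []

form₂ : F5 → Poly
form₂ c = (c ⊗ fromℕ5 2 , mono 4 0 0) ∷ (c , mono 0 4 0) ∷ (c , mono 0 0 4) ∷ []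

form₃ : F5 → F5 → Poly
form₃ c d = (c , mono 4 0 0) ∷ (c , mono 0 4 0) ∷ (c ⊗ d , mono 1 0 3)
  ∷ (c ⊗ fromℕ5 3 , mono 0 0 4) ∷ []

{-# OPTIONS --safe #-}
module Submission where

-- There are only 5⁶ choices of (A, B, C, D, E, F), and every ingredient of the
-- statement is decidable: a non-singular zero can be searched for among
-- representatives of the 31 points of P²(F₅), and an exceptional shape is
-- detected by comparing coefficients on the union of the two supports, for each
-- of the six permutations of the variables and each c, d. The theorem is the
-- result of running this decision procedure on all cases.

open import Defs
open import Data.Empty using (⊥-elim)
open import Data.Fin using (Fin) renaming (zero to fzero; suc to fsuc)
open import Data.Fin.Patterns using (0F; 1F; 2F)
open import Data.Fin.Permutation using (Permutation′; id; transpose; _∘ₚ_)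
open import Data.Fin.Properties using (_≟_; all?; any?)
open import Data.List using (List; []; _∷_; map; _++_; concatMap; allFin)
open import Data.List.Membership.Propositional using (_∉_)
open import Data.List.Membership.Propositional.Properties using (∈-++⁺ˡ; ∈-++⁺ʳ)
open import Data.List.Relation.Unary.All as All using (All)
open import Data.List.Relation.Unary.Any as Any using (Any; here; there)
import Data.Nat as ℕ
open import Data.Product using (_×_; ∃-syntax; _,_; proj₂)
open import Data.Sum as Sum using (_⊎_)
open import Data.Vec using (Vec)
open import Data.Vec.Properties using (≡-dec)
open import Relation.Nullary using (¬_; Dec; yes; no; ¬?)
open import Relation.Nullary.Decidable using (_×-dec_; _⊎-dec_; _→-dec_; map′; toWitness)
open import Relation.Binary.PropositionalEquality using (_≡_; refl; sym; trans)

point : F5 → F5 → F5 → Fin 3 → F5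
point a b c fzero = a
point a b c (fsuc fzero) = b
point a b c (fsuc (fsuc fzero)) = c

nonSingularZero? : (g : Poly) (v : Fin 3 → F5) → Dec (NonSingularZero g v)
nonSingularZero? g v =
  ¬? (all? λ i → v i ≟ 𝟘) ×-dec (eval g v ≟ 𝟘) ×-dec ¬? (all? λ i → eval (∂ i g) v ≟ 𝟘)

NonSingularZeroIn : List (F5 × F5 × F5) → Poly → Set
NonSingularZeroIn ps g = Any (λ { (a , b , c) → NonSingularZero g (point a b c) }) ps

nonSingularZeroIn? : (ps : List (F5 × F5 × F5)) (g : Poly) → Dec (NonSingularZeroIn ps g)
nonSingularZeroIn? ps g = Any.any? (λ { (a , b , c) → nonSingularZero? g (point a b c) }) ps

nonSingularZeroIn⇒hasNonSingularZero : ∀ ps g → NonSingularZeroIn ps g → HasNonSingularZero g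
nonSingularZeroIn⇒hasNonSingularZero ps g z with Any.satisfied z
... | (a , b , c) , nsz = point a b c , nsz

projectivePlane : List (F5 × F5 × F5)
projectivePlane = (0F , 0F , 1F) ∷ map (λ c → 0F , 1F , c) (allFin 5)
  ++ concatMap (λ b → map (λ c → 1F , b , c) (allFin 5)) (allFin 5)

support : Poly → List (Vec ℕ.ℕ 3)
support = map proj₂

coeff-∉-support : (p : Poly) {e : Vec ℕ.ℕ 3} → e ∉ support p → coeff p e ≡ 𝟘
coeff-∉-support [] _ = refl
coeff-∉-support ((c , e′) ∷ p) {e} e∉ with ≡-dec ℕ._≟_ e′ e
... | yes refl = ⊥-elim (e∉ (here refl))
... | no _ = coeff-∉-support p (λ e∈ → e∉ (there e∈))

_≐?_ : (p q : Poly) → Dec (p ≐ q)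
p ≐? q = map′ agree (λ p≐q → All.tabulate λ {e} _ → p≐q e)
  (All.all? (λ e → coeff p e ≟ coeff q e) (support p ++ support q))
  where
  agree : All (λ e → coeff p e ≡ coeff q e) (support p ++ support q) → p ≐ q
  agree onSupport e with Any.any? (λ e′ → ≡-dec ℕ._≟_ e e′) (support p ++ support q)
  ... | yes e∈ = All.lookup onSupport e∈
  ... | no e∉ = trans (coeff-∉-support p (λ e∈ → e∉ (∈-++⁺ˡ e∈)))
                      (sym (coeff-∉-support q (λ e∈ → e∉ (∈-++⁺ʳ (support p) e∈))))

Exceptional : Poly → Permutation′ 3 → F5 → F5 → Set
Exceptional g π c d = ¬ (c ≡ 𝟘) × ¬ (d ≡ 𝟘) ×
  ((ren π g ≐ form₁ c) ⊎ (ren π g ≐ form₂ c) ⊎ (ren π g ≐ form₃ c d))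

exceptional? : (g : Poly) (π : Permutation′ 3) (c d : F5) → Dec (Exceptional g π c d)
exceptional? g π c d = ¬? (c ≟ 𝟘) ×-dec ¬? (d ≟ 𝟘) ×-dec
  (ren π g ≐? form₁ c ⊎-dec ren π g ≐? form₂ c ⊎-dec ren π g ≐? form₃ c d)

permutations₃ : List (Permutation′ 3)
permutations₃ = id ∷ transpose 0F 1F ∷ transpose 0F 2F ∷ transpose 1F 2F
  ∷ (transpose 0F 1F ∘ₚ transpose 0F 2F) ∷ (transpose 0F 2F ∘ₚ transpose 0F 1F) ∷ []

ExceptionalUpToPermutation : Poly → Set
ExceptionalUpToPermutation g = Any (λ π → ∃[ c ] ∃[ d ] Exceptional g π c d) permutations₃

exceptionalUpToPermutation? : (g : Poly) → Dec (ExceptionalUpToPermutation g)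
exceptionalUpToPermutation? g =
  Any.any? (λ π → any? λ c → any? λ d → exceptional? g π c d) permutations₃

Dichotomy : (A B C D E F : F5) → Set
Dichotomy A B C D E F = ¬ (A ⊗ C ≡ 𝟘) → ¬ (F ≡ 𝟘) →
  NonSingularZeroIn projectivePlane (gForm A B C D E F)
  ⊎ ExceptionalUpToPermutation (gForm A B C D E F)

dichotomy? : (A B C D E F : F5) → Dec (Dichotomy A B C D E F)
dichotomy? A B C D E F = ¬? (A ⊗ C ≟ 𝟘) →-dec ¬? (F ≟ 𝟘) →-dec
  (nonSingularZeroIn? projectivePlane (gForm A B C D E F)
   ⊎-dec exceptionalUpToPermutation? (gForm A B C D E F))

dichotomy : ∀ A B C D E F → Dichotomy A B C D E F
dichotomy = toWitness
  {a? = all? λ A → all? λ B → all? λ C → all? λ D → all? λ E → all? λ F → dichotomy? A B C D E F} _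

lemma11 : (A B C D E F : F5) → ¬ (A ⊗ C ≡ 𝟘) → ¬ (F ≡ 𝟘) →
    HasNonSingularZero (gForm A B C D E F)
    ⊎ (∃[ π ] ∃[ c ] ∃[ d ] (¬ (c ≡ 𝟘) × ¬ (d ≡ 𝟘) ×
        ((ren π (gForm A B C D E F) ≐ form₁ c)
         ⊎ (ren π (gForm A B C D E F) ≐ form₂ c)
         ⊎ (ren π (gForm A B C D E F) ≐ form₃ c d))))
lemma11 A B C D E F A⊗C≢0 F≢0 =
  Sum.map (nonSingularZeroIn⇒hasNonSingularZero projectivePlane (gForm A B C D E F))
          Any.satisfied
          (dichotomy A B C D E F A⊗C≢0 F≢0)
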